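{- Let $R$ be a generic rectangulation of size $n$, let $x$ be a 2-clumped permutation with $\gamma(x)=R$, and let $T$ be a set that is good with respect to $x$, with $T^C=[n]\setminus T$. Let $\mathrm{rf}_{\mathrm{main}}(R)$ denote the generic rectangulation obtained by reflecting $R$ about the upper-left to lower-right diagonal of the square $S$. Then $x_{\min}(R,T)|_{T^C}=\mathrm{rp}\big(x_{\max}(\mathrm{rf}_{\mathrm{main}}(R), T^C)|_{T^C}\big)$.
   Context: A generic rectangulation is a tiling of a square $S$ by rectangles with no four sharing a vertex, up to combinatorial equivalence. There is a surjective map $\gamma$ from $S_n$ to generic rectangulations of size $n$; its fibers are intervals of the right weak order, each containing a unique 2-clumped permutation (its minimal element). For $x$ with $\gamma(x)=R$, a subset $T\subseteq[n]$ is good with respect to $x$ if some permutation $x'$ with $\gamma(x')=R$ has first $|T|$ entries equal to $T$. For such $T$, $x_{\min}(R,T)$ (resp. $x_{\max}(R,T)$) is the minimal (resp. maximal) element in the right weak order on $S_n$ among permutations $x'$ with $\gamma(x')=R$ whose first $|T|$ entries form $T$; $x_{\min}(R,T)|_{T^C}$ denotes the ordering of the elements of $T^C$ as they appear in $x_{\min}(R,T)$, and similarly for $x_{\max}$ (with the roles of the rectangulation and good set indicated in the arguments; in the right-hand side, $T^C$ is good with respect to the 2-clumped permutation mapping to $\mathrm{rf}_{\mathrm{main}}(R)$). The map $\mathrm{rp}$ reverses the order of the entries of a sequence. One has $\mathrm{rf}_{\mathrm{main}}\circ\gamma=\gamma\circ\mathrm{rp}$. -}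

module Defs where

open import Data.Nat using (ℕ; _<_)
open import Data.Bool using (Bool; true; false; not)
open import Data.List using (List; []; _∷_; _++_; upTo; reverse; filterᵇ)
open import Data.List.Membership.Propositional using (_∈_)
open import Data.List.Relation.Unary.All using (All)
open import Data.List.Relation.Binary.Permutation.Propositional using (_↭_)
open import Data.Product using (Σ; ∃; ∃-syntax; _×_; _,_)
open import Data.Sum using (_⊎_)
open import Relation.Nullary using (¬_)
open import Relation.Binary.PropositionalEquality using (_≡_)
open import Relation.Binary.Construct.Closure.Equivalence using (EqClosure)

-- Permutations of size n, in one-line notation, on the values 0,…,n-1.
Perm : ℕ → List ℕ → Set
Perm n xs = xs ↭ upTo n

Alternating : List ℕ → List ℕ → ℕ → ℕ → Set
Alternating side₁ side₂ a c =
  ∃[ b₁ ] ∃[ b₂ ] ∃[ b₃ ]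
    (a < b₁ × b₁ < b₂ × b₂ < b₃ × b₃ < c ×
     b₁ ∈ side₁ × b₂ ∈ side₂ × b₃ ∈ side₁)

-- For adjacent entries a, c (in some order) with prefix l and suffix r:
-- the values strictly between a and c form at least three "clumps",
-- i.e. an occurrence of 3-51-2-4, 3-51-4-2, 2-4-51-3 or 4-2-51-3
-- (resp. of the corresponding patterns with 15 in place of 51).
ThreeClumps : List ℕ → List ℕ → ℕ → ℕ → Set
ThreeClumps l r a c = Alternating l r a c ⊎ Alternating r l a c

TwoClumped : List ℕ → Set
TwoClumped xs = ∀ l a c r → xs ≡ l ++ c ∷ a ∷ r → a < c → ¬ ThreeClumps l r a c

-- Covering relations of the right weak order (swap of adjacent positions
-- creating an inversion) which are contracted by γ.
data ContractedCover : List ℕ → List ℕ → Set where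
  swap : ∀ l a c r → a < c → ThreeClumps l r a c →
         ContractedCover (l ++ a ∷ c ∷ r) (l ++ c ∷ a ∷ r)

-- γ(x) = γ(y): x and y lie in the same fiber of γ (the equivalence
-- classes of the lattice congruence generated by the contracted covers).
SameRect : List ℕ → List ℕ → Set
SameRect = EqClosure ContractedCover

Before : List ℕ → ℕ → ℕ → Set
Before xs c a = ∃[ l ] ∃[ r ] (xs ≡ l ++ c ∷ r × a ∈ r)

-- Right weak order: containment of inversion sets (inversions as pairs of values).
_≤W_ : List ℕ → List ℕ → Set
x ≤W y = ∀ a c → a < c → Before x c a → Before y c a

In : (ℕ → Bool) → ℕ → Set
In T v = T v ≡ true

HasPrefix : (ℕ → Bool) → List ℕ → Set
HasPrefix T x = ∃[ p ] ∃[ s ] (x ≡ p ++ s × All (In T) p × All (λ v → T v ≡ false) s)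

Good : (ℕ → Bool) → List ℕ → Set
Good T x = ∃[ x' ] (SameRect x x' × HasPrefix T x')

compl : (ℕ → Bool) → (ℕ → Bool)
compl T v = not (T v)

FiberPrefix : List ℕ → (ℕ → Bool) → List ℕ → Set
FiberPrefix x T x' = SameRect x x' × HasPrefix T x'

IsMinimum : (List ℕ → Set) → List ℕ → Set
IsMinimum S m = S m × (∀ y → S y → m ≤W y)

IsMaximum : (List ℕ → Set) → List ℕ → Set
IsMaximum S M = S M × (∀ y → S y → y ≤W M)

restrict : List ℕ → (ℕ → Bool) → List ℕ
restrict y U = filterᵇ U y

rp : List ℕ → List ℕ
rp = reverse

{-# OPTIONS --safe #-}
-- Reversing one-line notation turns inversions into non-inversions, so it reverses the
-- right weak order. It maps contracted covers to contracted covers (the two sides of a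
-- three-clump witness trade places), hence the fiber of x onto that of rp x, and it turns
-- the prefix set T into T^C. So rp exchanges the two sets whose extrema are taken, giving
-- x_min(R,T) = rp (x_max(rf_main(R), T^C)); and restriction to T^C commutes with rp.
module Submission where

open import Defs
open import Data.Nat using (ℕ)
open import Data.Bool using (Bool)
open import Data.List using (List)
open import Relation.Binary.PropositionalEquality using (_≡_)

open import Level using (Level)
open import Function using (_∘_)
open import Data.Nat using (_≟_; <-cmp)
open import Data.Bool using (true; false; not; T?)
open import Data.Bool.Properties using (not-involutive)
open import Data.List using ([]; _∷_; _++_; [_]; reverse; filter)
open import Data.List.Properties using (reverse-++; unfold-reverse; ++-assoc; ++-identityʳ; reverse-involutive; filter-++)
open import Data.List.Membership.Propositional using (_∈_)
open import Data.List.Membership.Propositional.Properties using (∈-∃++; ∈-insert; ∈-++⁺ʳ)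
open import Data.List.Relation.Unary.Any using (here; there)
import Data.List.Relation.Unary.Any.Properties as Any
open import Data.List.Relation.Unary.All as All using (All)
open import Data.List.Relation.Unary.AllPairs using (_∷_)
open import Data.List.Relation.Unary.Unique.Propositional using (Unique)
open import Data.List.Relation.Unary.Unique.Propositional.Properties using (upTo⁺)
open import Data.List.Relation.Binary.Permutation.Propositional using (_↭_; ↭-refl; ↭-sym; ↭-trans; ↭-isEquivalence; ↭⇒↭ₛ; module PermutationReasoning) renaming (swap to ↭-swap)
open import Data.List.Relation.Binary.Permutation.Propositional.Properties using (¬x∷xs↭[]; ∈-resp-↭; All-resp-↭; ++⁺ˡ; drop-∷; ↭-reverse)
import Data.List.Relation.Binary.Permutation.Setoid.Properties as Permutationₛ
open import Relation.Binary.PropositionalEquality using (_≢_; refl; sym; trans; cong; subst; setoid; ≢-sym; module ≡-Reasoning)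
import Relation.Binary.Construct.Closure.Equivalence as EqClosure
open import Relation.Binary.Definitions using (tri<; tri≈; tri>)
open import Relation.Unary using (Pred; Decidable)
open import Relation.Nullary using (does; yes; no; contradiction)
open import Data.Product using (_,_)
import Data.Sum as Sum

private
  variable
    a p : Level
    A : Set a
    a′ c′ u v w : ℕ
    l l′ r r′ : List ℕ
    xs ys zs : List ℕ

reverse-++-∷ : ∀ (xs : List A) x ys → reverse (xs ++ x ∷ ys) ≡ reverse ys ++ x ∷ reverse xs
reverse-++-∷ xs x ys = begin
  reverse (xs ++ x ∷ ys)             ≡⟨ reverse-++ xs (x ∷ ys) ⟩
  reverse (x ∷ ys) ++ reverse xs     ≡⟨ cong (_++ reverse xs) (unfold-reverse x ys) ⟩
  (reverse ys ++ [ x ]) ++ reverse xs ≡⟨ ++-assoc (reverse ys) [ x ] (reverse xs) ⟩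
  reverse ys ++ x ∷ reverse xs       ∎
  where open ≡-Reasoning

reverse-++-∷-∷ : ∀ (xs : List A) x y ys → reverse (xs ++ x ∷ y ∷ ys) ≡ reverse ys ++ y ∷ x ∷ reverse xs
reverse-++-∷-∷ xs x y ys = begin
  reverse (xs ++ x ∷ y ∷ ys)               ≡⟨ reverse-++-∷ xs x (y ∷ ys) ⟩
  reverse (y ∷ ys) ++ x ∷ reverse xs       ≡⟨ cong (_++ x ∷ reverse xs) (unfold-reverse y ys) ⟩
  (reverse ys ++ [ y ]) ++ x ∷ reverse xs  ≡⟨ ++-assoc (reverse ys) [ y ] (x ∷ reverse xs) ⟩
  reverse ys ++ y ∷ x ∷ reverse xs         ∎
  where open ≡-Reasoning

All-reverse : {P : Pred A p} {xs : List A} → All P xs → All P (reverse xs)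
All-reverse {xs = xs} = All-resp-↭ (↭-sym (↭-reverse xs))

filter-reverse : {P : Pred A p} (P? : Decidable P) (xs : List A) →
                 filter P? (reverse xs) ≡ reverse (filter P? xs)
filter-reverse P? [] = refl
filter-reverse P? (x ∷ xs) = begin
  filter P? (reverse (x ∷ xs))              ≡⟨ cong (filter P?) (unfold-reverse x xs) ⟩
  filter P? (reverse xs ++ [ x ])           ≡⟨ filter-++ P? (reverse xs) [ x ] ⟩
  filter P? (reverse xs) ++ filter P? [ x ] ≡⟨ cong (_++ filter P? [ x ]) (filter-reverse P? xs) ⟩
  reverse (filter P? xs) ++ filter P? [ x ] ≡⟨ snoc-filter ⟩
  reverse (filter P? (x ∷ xs))              ∎
  where
  open ≡-Reasoning
  snoc-filter : reverse (filter P? xs) ++ filter P? [ x ] ≡ reverse (filter P? (x ∷ xs))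
  snoc-filter with does (P? x)
  ... | true  = sym (unfold-reverse x (filter P? xs))
  ... | false = ++-identityʳ (reverse (filter P? xs))

Unique-resp-↭ : xs ↭ ys → Unique xs → Unique ys
Unique-resp-↭ xs↭ys = Permutationₛ.Unique-resp-↭ (setoid ℕ) (↭⇒↭ₛ xs↭ys)

Before⇒∈ : Before xs u v → u ∈ xs
Before⇒∈ (l , _ , refl , _) = ∈-insert l

Before-∷⇒∈ : Before (w ∷ xs) u v → v ∈ xs
Before-∷⇒∈ ([]    , _ , refl , v∈r) = v∈r
Before-∷⇒∈ (_ ∷ l , _ , refl , v∈r) = ∈-++⁺ʳ l (there v∈r)

Before-head : v ∈ xs → Before (u ∷ xs) u v
Before-head {xs = xs} v∈xs = [] , xs , refl , v∈xs

Before-∷⁺ : Before xs u v → Before (w ∷ xs) u v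
Before-∷⁺ {w = w} (l , r , refl , v∈r) = w ∷ l , r , refl , v∈r

Before-∷⁻ : u ≢ w → Before (w ∷ xs) u v → Before xs u v
Before-∷⁻ u≢w ([]    , _ , refl , _)   = contradiction refl u≢w
Before-∷⁻ _   (_ ∷ l , r , refl , v∈r) = l , r , refl , v∈r

Before-reverse : Before xs u v → Before (reverse xs) v u
Before-reverse {u = u} {v = v} (l , r , refl , v∈r) with ∈-∃++ v∈r
... | r₁ , r₂ , refl = reverse r₂ , reverse (l ++ u ∷ r₁) , split , Any.reverse⁺ (∈-insert l)
  where
  open ≡-Reasoning
  split : reverse (l ++ u ∷ r₁ ++ v ∷ r₂) ≡ reverse r₂ ++ v ∷ reverse (l ++ u ∷ r₁)
  split = begin
    reverse (l ++ u ∷ r₁ ++ v ∷ r₂)       ≡⟨ cong reverse (++-assoc l (u ∷ r₁) (v ∷ r₂)) ⟨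
    reverse ((l ++ u ∷ r₁) ++ v ∷ r₂)     ≡⟨ reverse-++-∷ (l ++ u ∷ r₁) v r₂ ⟩
    reverse r₂ ++ v ∷ reverse (l ++ u ∷ r₁) ∎

Before-determines : Unique ys → ys ↭ zs →
                    (∀ {u v} → u ≢ v → Before ys u v → Before zs u v) → ys ≡ zs
Before-determines {[]}    {[]}    _ _     _ = refl
Before-determines {[]}    {_ ∷ _} _ ys↭zs _ = contradiction (↭-sym ys↭zs) ¬x∷xs↭[]
Before-determines {_ ∷ _} {[]}    _ ys↭zs _ = contradiction ys↭zs ¬x∷xs↭[]
Before-determines {u ∷ ys} {w ∷ zs} ys!@(u∉ys ∷ ys-tail!) ys↭zs agree with u ≟ w
... | yes refl = cong (u ∷_) (Before-determines ys-tail! (drop-∷ ys↭zs) agree-tail)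
  where
  agree-tail : ∀ {u′ v} → u′ ≢ v → Before ys u′ v → Before zs u′ v
  agree-tail u′≢v b = Before-∷⁻ (≢-sym (All.lookup u∉ys (Before⇒∈ b))) (agree u′≢v (Before-∷⁺ b))
... | no u≢w with ∈-resp-↭ (↭-sym ys↭zs) (here refl)
...   | here w≡u  = contradiction (sym w≡u) u≢w
...   | there w∈ys with Unique-resp-↭ ys↭zs ys!
...     | w∉zs ∷ _ = contradiction refl (All.lookup w∉zs (Before-∷⇒∈ (agree u≢w (Before-head w∈ys))))

Alternating-mono : (∀ {b} → b ∈ l → b ∈ l′) → (∀ {b} → b ∈ r → b ∈ r′) →
                   Alternating l r a′ c′ → Alternating l′ r′ a′ c′
Alternating-mono l⊆l′ r⊆r′ (b₁ , b₂ , b₃ , a<b₁ , b₁<b₂ , b₂<b₃ , b₃<c , b₁∈l , b₂∈r , b₃∈l) =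
  b₁ , b₂ , b₃ , a<b₁ , b₁<b₂ , b₂<b₃ , b₃<c , l⊆l′ b₁∈l , r⊆r′ b₂∈r , l⊆l′ b₃∈l

ThreeClumps-reverse : ThreeClumps l r a′ c′ → ThreeClumps (reverse r) (reverse l) a′ c′
ThreeClumps-reverse = Sum.swap ∘ Sum.map reverse-sides reverse-sides
  where
  reverse-sides : Alternating l r a′ c′ → Alternating (reverse l) (reverse r) a′ c′
  reverse-sides = Alternating-mono Any.reverse⁺ Any.reverse⁺

ContractedCover-reverse : ContractedCover ys zs → ContractedCover (reverse zs) (reverse ys)
ContractedCover-reverse (swap l a c r a<c clumps)
  rewrite reverse-++-∷-∷ l a c r | reverse-++-∷-∷ l c a r =
  swap (reverse r) a c (reverse l) a<c (ThreeClumps-reverse clumps)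

SameRect-reverse : SameRect ys zs → SameRect (reverse ys) (reverse zs)
SameRect-reverse = EqClosure.gfold (EqClosure.isEquivalence ContractedCover) reverse
  (EqClosure.symmetric ContractedCover ∘ EqClosure.return ∘ ContractedCover-reverse)

ContractedCover⇒↭ : ContractedCover ys zs → ys ↭ zs
ContractedCover⇒↭ (swap l a c r _ _) = ++⁺ˡ l (↭-swap a c ↭-refl)

SameRect⇒↭ : SameRect ys zs → ys ↭ zs
SameRect⇒↭ = EqClosure.fold ↭-isEquivalence ContractedCover⇒↭

HasPrefix-reverse : ∀ {T U : ℕ → Bool} → (∀ v → U v ≡ not (T v)) →
                    HasPrefix T ys → HasPrefix U (reverse ys)
HasPrefix-reverse {T = T} {U} U≡¬T (p , s , refl , p⊆T , s∩T≡∅) =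
  reverse s , reverse p , reverse-++ p s ,
  All-reverse (All.map negate s∩T≡∅) , All-reverse (All.map negate p⊆T)
  where
  negate : ∀ {v b} → T v ≡ b → U v ≡ not b
  negate {v} refl = U≡¬T v

FiberPrefix-reverse : ∀ {x T y} → FiberPrefix x T y → FiberPrefix (rp x) (compl T) (rp y)
FiberPrefix-reverse (x~y , prefix) = SameRect-reverse x~y , HasPrefix-reverse (λ _ → refl) prefix

FiberPrefix-reverse⁻ : ∀ {x T y} → FiberPrefix (rp x) (compl T) y → FiberPrefix x T (rp y)
FiberPrefix-reverse⁻ {x} {T} {y} (rp-x~y , prefix) =
  subst (λ z → SameRect z (rp y)) (reverse-involutive x) (SameRect-reverse rp-x~y) ,
  HasPrefix-reverse (λ v → sym (not-involutive (T v))) prefix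

minimum≡reverse-maximum : ∀ {S S′ : List ℕ → Set} {m M} →
  (∀ {y} → S y → S′ (rp y)) → (∀ {y} → S′ y → S (rp y)) →
  Unique m → m ↭ rp M → IsMinimum S m → IsMaximum S′ M → m ≡ rp M
minimum≡reverse-maximum {m = m} {M} S⇒S′ S′⇒S m! m↭M (m∈S , m-least) (M∈S′ , M-greatest) =
  Before-determines m! m↭M agree
  where
  agree : ∀ {u v} → u ≢ v → Before m u v → Before (rp M) u v
  agree {u} {v} u≢v u-before-v with <-cmp u v
  ... | tri< u<v _ _ = Before-reverse (M-greatest (rp m) (S⇒S′ m∈S) u v u<v (Before-reverse u-before-v))
  ... | tri≈ _ u≡v _ = contradiction u≡v u≢v
  ... | tri> _ _ v<u = m-least (rp M) (S′⇒S M∈S′) v u v<u u-before-v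

lemma5p8 : (n : ℕ) (x : List ℕ) → Perm n x → TwoClumped x →
    (T : ℕ → Bool) → Good T x →
    (xmin xmax : List ℕ) →
    IsMinimum (FiberPrefix x T) xmin →
    IsMaximum (FiberPrefix (rp x) (compl T)) xmax →
    restrict xmin (compl T) ≡ rp (restrict xmax (compl T))
lemma5p8 n x x-perm _ T _ xmin xmax xmin-min@((x~xmin , _) , _) xmax-max@((rp-x~xmax , _) , _) =
  trans (cong (λ y → restrict y (compl T)) xmin≡rp-xmax) (filter-reverse (T? ∘ compl T) xmax)
  where
  x↭xmin : x ↭ xmin
  x↭xmin = SameRect⇒↭ x~xmin
  xmin↭rp-xmax : xmin ↭ rp xmax
  xmin↭rp-xmax = begin
    xmin     ↭⟨ x↭xmin ⟨
    x        ↭⟨ ↭-reverse x ⟨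
    rp x     ↭⟨ SameRect⇒↭ rp-x~xmax ⟩
    xmax     ↭⟨ ↭-reverse xmax ⟨
    rp xmax  ∎
    where open PermutationReasoning
  xmin≡rp-xmax : xmin ≡ rp xmax
  xmin≡rp-xmax = minimum≡reverse-maximum FiberPrefix-reverse FiberPrefix-reverse⁻
    (Unique-resp-↭ (↭-trans (↭-sym x-perm) x↭xmin) (upTo⁺ n)) xmin↭rp-xmax xmin-min xmax-max
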